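{- In the setting described in the context, an error state is reachable from the initial state $(pc_0,d_0)$ in the original transition system $\langle S,\to\rangle$ if and only if an error state is reachable from the initial state $(pc_0',d_0)$ in the instrumented transition system $\langle S',\to'\rangle$.
   Context: A concurrent program has a finite set $T$ of threads. Let $D$ be the set of data valuations (maps from variables to values); an action is a binary relation $\alpha\subseteq D\times D$. Thread $i$ has a control flow graph $G_i=(V_i,\delta_i)$ with finite location set $V_i$ and edges $\delta_i\subseteq V_i\times A\times V_i$ ($A$ a set of actions), an initial location $l_{0,i}$, and a designated sink location $l_{sink,i}\in V_i$ having no outgoing edges. Let $d_0\in D$ be the initial data valuation. The original transition system has states $S=(\prod_i V_i)\times D$, with $(pc,d)\xrightarrow{\alpha}_i(pc',d')$ iff $(pc_i,\alpha,l')\in\delta_i$, $(d,d')\in\alpha$ and $pc'=pc[i:=l']$ (i.e. $pc'_i=l'$, $pc'_j=pc_j$ for $j\ne i$); $\to_i=\bigcup_\alpha\xrightarrow{\alpha}_i$, $\to=\bigcup_i\to_i$; initial state $(pc_0,d_0)$ with $pc_{0,i}=l_{0,i}$. A state is an error state iff some thread $i$ has $pc_i=l_{sink,i}$. Notation: for $X\subseteq S$, $Q\subseteq S\times S$: $X\lhd Q=Q\cap(X\times S)$, $Q\rhd X=Q\cap (S\times X)$, $\overline X=S\setminus X$. For each edge $(l,\alpha,l')\in\delta_i$ a state predicate $c_\alpha\subseteq S$ is given which is a dynamic both-moving condition: for every $j\neq i$, $(c_\alpha\lhd\xrightarrow{\alpha}_i)\circ(c_\alpha\lhd\to_j)=(c_\alpha\lhd\to_j)\circ(c_\alpha\lhd\xrightarrow{\alpha}_i)$,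 and $c_\alpha\lhd\to_j\rhd\overline{c_\alpha}=c_\alpha\lhd\xrightarrow{\alpha}_i\rhd\overline{c_\alpha}=\emptyset$. For each $i$ a location feedback set $LFS_i\subseteq V_i$ is fixed, i.e. every cycle of $G_i$ contains a location in $LFS_i$. For $l\in V_i$ let $c(l)=\bigcap_{(l,\alpha,l_b)\in\delta_i}c_\alpha$ (equal to $S$ if $l$ has no outgoing edge). Instrumentation: $V_i'=\{l^N,l^R,l^L,l^{R'},l^{L'}: l\in V_i\}$ (five distinct copies of each location). Edges of $G_i'$ carry a guard $g\subseteq S$ and an action $\beta\subseteq D\times D$ ("true" means guard $S$ and identity action): R1: for each $(l_a,\alpha,l_b)\in\delta_i$: edges $l_a^N\to l_b^R$ with guard $c_\alpha$, action $\alpha$, and $l_a^N\to l_b^L$ with guard $\overline{c_\alpha}$, action $\alpha$; R2: for each $(l_a,\alpha,l_b)\in\delta_i$: the same two edges from $l_a^{R'}$ (to $l_b^R$ with guard $c_\alpha$, to $l_b^L$ with guard $\overline{c_\alpha}$, both with action $\alpha$); R3: for each $l_a\in V_i$: edge $l_a^R\to l_a^{R'}$, true; R4: for each $l_a\in V_i\setminus LFS_i$: edges $l_a^L\to l_a^{L'}$ with guard $c(l_a)$ and $l_a^L\to l_a^N$ with guard $\overline{c(l_a)}$, both with identity action; R5: for each $(l_a,\alpha,l_b)\in\delta_i$ with $l_a\notin LFS_i$: edge $l_a^{L'}\to l_b^L$ with guard $S$ and action $\alpha$; R6: for each $l_a\in LFS_i$: edge $l_a^L\to l_a^N$, true. The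 instrumented transition system has states $S'=(\prod_i V_i')\times D$. Let $\pi:S'\to S$ replace every location copy $l^X$ by $l$ (guards are evaluated through $\pi$). $(pc,d)\to'_i(pc',d')$ iff $G_i'$ has an edge from $pc_i$ to $l'$ with guard $g$ and action $\beta$ such that $\pi(pc,d)\in g$, $(d,d')\in\beta$, $pc'=pc[i:=l']$; $\to'=\bigcup_i\to'_i$. Initial state $(pc_0',d_0)$ with $pc'_{0,i}=l_{0,i}^N$. A state of $S'$ is an error state iff some thread $i$ has $pc_i\in\{l_{sink,i}^N,l_{sink,i}^R,l_{sink,i}^L\}$. -}

module Defs where

open import Data.Nat using (ℕ)
open import Data.Fin using (Fin)
open import Data.Product using (Σ; ∃; _×_; _,_; proj₁; proj₂)
open import Data.Sum using (_⊎_)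
open import Data.Empty using (⊥)
open import Relation.Nullary using (¬_)
open import Relation.Binary.PropositionalEquality using (_≡_; _≢_)
open import Relation.Binary.Construct.Closure.ReflexiveTransitive using (Star)
open import Function.Bundles using (_⇔_)

PC : (n : ℕ) → (Fin n → ℕ) → Set
PC n V = (i : Fin n) → Fin (V i)

State : (Var Value : Set) (n : ℕ) → (Fin n → ℕ) → Set
State Var Value n V = PC n V × (Var → Value)

-- A concurrent program: threads Fin n, finite location sets Fin (V i),
-- edges of thread i indexed by the type E i (each edge has source, action,
-- target), initial and sink locations, the condition c_α per edge and the
-- location feedback set LFS_i (as a predicate on locations).
record Program (Var Value : Set) : Set₁ where
  field
    n      : ℕ
    V      : Fin n → ℕ
    E      : Fin n → Set
    src    : ∀ {i} → E i → Fin (V i)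
    tgt    : ∀ {i} → E i → Fin (V i)
    act    : ∀ {i} → E i → (Var → Value) → (Var → Value) → Set
    l₀     : (i : Fin n) → Fin (V i)
    sink   : (i : Fin n) → Fin (V i)
    cond   : ∀ {i} → E i → State Var Value n V → Set
    LFS    : ∀ {i} → Fin (V i) → Set

-- The five copies of a location.
data Tag : Set where
  N R L R' L' : Tag

module Semantics {Var Value : Set} (P : Program Var Value) where
  open Program P

  D : Set
  D = Var → Value

  S : Set
  S = State Var Value n V

  SRel : Set₁
  SRel = S → S → Set

  _◁_ : (S → Set) → SRel → SRel
  (X ◁ Q) s s' = X s × Q s s'

  _⨾_ : SRel → SRel → SRel
  (Q₁ ⨾ Q₂) s s'' = Σ S λ s' → Q₁ s s' × Q₂ s' s''

  _≐_ : SRel → SRel → Set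
  Q₁ ≐ Q₂ = ∀ s s' → Q₁ s s' ⇔ Q₂ s s'

  Empty◁▷̄ : (S → Set) → SRel → (S → Set) → Set
  Empty◁▷̄ X Q Y = ∀ s s' → X s → Q s s' → ¬ Y s' → ⊥

  StepE : (i : Fin n) → E i → SRel
  StepE i e (pc , d) (pc' , d') =
    src e ≡ pc i × act e d d' × pc' i ≡ tgt e × (∀ j → j ≢ i → pc' j ≡ pc j)

  Step : Fin n → SRel
  Step i s s' = Σ (E i) λ e → StepE i e s s'

  Step→ : SRel
  Step→ s s' = Σ (Fin n) λ i → Step i s s'

  init : D → S
  init d₀ = l₀ , d₀

  Error : S → Set
  Error (pc , d) = Σ (Fin n) λ i → pc i ≡ sink i

  ErrorReachable : D → Set
  ErrorReachable d₀ = Σ S λ s → Star Step→ (init d₀) s × Error s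

  cloc : ∀ {i} → Fin (V i) → S → Set
  cloc {i} l s = (e : E i) → src e ≡ l → cond e s

  SinkNoOut : Set
  SinkNoOut = ∀ i (e : E i) → src e ≢ sink i

  data Walk (i : Fin n) : Fin (V i) → Fin (V i) → Set where
    []  : ∀ {l} → Walk i l l
    _∷_ : ∀ {l} (e : E i) → Walk i (tgt e) l → Walk i (src e) l

  VisitsLFS : ∀ {i l l'} → Walk i l l' → Set
  VisitsLFS []      = ⊥
  VisitsLFS (e ∷ w) = LFS (src e) ⊎ VisitsLFS w

  -- every cycle (nonempty closed walk) contains a location in LFS_i
  FeedbackSets : Set
  FeedbackSets = ∀ i (e : E i) (w : Walk i (tgt e) (src e)) → VisitsLFS (e ∷ w)

  BothMoving : Set
  BothMoving = ∀ i (e : E i) (j : Fin n) → j ≢ i →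
      (((cond e ◁ StepE i e) ⨾ (cond e ◁ Step j)) ≐ ((cond e ◁ Step j) ⨾ (cond e ◁ StepE i e)))
    × Empty◁▷̄ (cond e) (Step j) (cond e)
    × Empty◁▷̄ (cond e) (StepE i e) (cond e)

  Loc' : Fin n → Set
  Loc' i = Tag × Fin (V i)

  S' : Set
  S' = ((i : Fin n) → Loc' i) × D

  π : S' → S
  π (pc , d) = (λ i → proj₂ (pc i)) , d

  -- Move i s a d d' b : G'_i has an edge a → b whose guard holds at s (= π of
  -- the current state) and whose action relates d to d'.  Identity actions
  -- are expressed by d' = d.
  data Move (i : Fin n) (s : S) : Loc' i → D → D → Loc' i → Set where
    r1c : ∀ {d d'} (e : E i) → cond e s → act e d d' → Move i s (N , src e) d d' (R , tgt e)
    r1n : ∀ {d d'} (e : E i) → ¬ cond e s → act e d d' → Move i s (N , src e) d d' (L , tgt e)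
    r2c : ∀ {d d'} (e : E i) → cond e s → act e d d' → Move i s (R' , src e) d d' (R , tgt e)
    r2n : ∀ {d d'} (e : E i) → ¬ cond e s → act e d d' → Move i s (R' , src e) d d' (L , tgt e)
    r3  : ∀ {d} (l : Fin (V i)) → Move i s (R , l) d d (R' , l)
    r4c : ∀ {d} (l : Fin (V i)) → ¬ LFS l → cloc l s → Move i s (L , l) d d (L' , l)
    r4n : ∀ {d} (l : Fin (V i)) → ¬ LFS l → ¬ cloc l s → Move i s (L , l) d d (N , l)
    r5  : ∀ {d d'} (e : E i) → ¬ LFS (src e) → act e d d' → Move i s (L' , src e) d d' (L , tgt e)
    r6  : ∀ {d} (l : Fin (V i)) → LFS l → Move i s (L , l) d d (N , l)

  IStep : Fin n → S' → S' → Set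
  IStep i (pc , d) (pc' , d') =
    Move i (π (pc , d)) (pc i) d d' (pc' i) × (∀ j → j ≢ i → pc' j ≡ pc j)

  IStep→ : S' → S' → Set
  IStep→ s s' = Σ (Fin n) λ i → IStep i s s'

  init' : D → S'
  init' d₀ = (λ i → N , l₀ i) , d₀

  Error' : S' → Set
  Error' (pc , d) = Σ (Fin n) λ i →
    (pc i ≡ (N , sink i)) ⊎ (pc i ≡ (R , sink i)) ⊎ (pc i ≡ (L , sink i))

  ErrorReachable' : D → Set
  ErrorReachable' d₀ = Σ S' λ s → Star IStep→ (init' d₀) s × Error' s

-- Forward, a step of thread i along an edge is matched by at most one stuttering move
-- (R → R', L → N or L → L') that brings the thread to a copy from which the edge may
-- fire (N, R', or L' outside LFS_i), followed by the copy of the edge, which lands in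
-- an N, R or L copy; these are exactly the copies counted by instrumented error states.
-- Backward, every instrumented move either leaves π unchanged or, under π, is a step
-- along an original edge.  Excluded middle decides the guards.

module Submission where

open import Defs
open import Level using (Level; 0ℓ)
open import Axiom.ExcludedMiddle using (ExcludedMiddle)
open import Function.Bundles using (_⇔_; mk⇔)
open import Data.Nat using (ℕ)
open import Data.Fin using (Fin; _≟_)
open import Data.Product using (∃; _×_; _,_; proj₁; proj₂)
open import Data.Sum using (_⊎_; inj₁; inj₂)
open import Relation.Nullary using (¬_; yes; no; contradiction)
open import Relation.Binary.Core using (Rel; REL)
open import Relation.Binary.PropositionalEquality
open import Relation.Binary.Construct.Closure.ReflexiveTransitive using (Star; ε; _◅_; _◅◅_)

module _ {a b r ℓ ℓ′ : Level} {A : Set a} {B : Set b}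
         {_⟶_ : Rel A ℓ} {_⟶′_ : Rel B ℓ′} (_∼_ : REL A B r)
         (simulate : ∀ {x x′ y} → x ∼ y → x ⟶ x′ → ∃ λ y′ → Star _⟶′_ y y′ × x′ ∼ y′)
         where

  simulate-star : ∀ {x x′ y} → x ∼ y → Star _⟶_ x x′ → ∃ λ y′ → Star _⟶′_ y y′ × x′ ∼ y′
  simulate-star x∼y ε = _ , ε , x∼y
  simulate-star x∼y (step ◅ steps) with simulate x∼y step
  ... | _ , run , x₁∼y₁ with simulate-star x₁∼y₁ steps
  ... | _ , run′ , x′∼y′ = _ , run ◅◅ run′ , x′∼y′

  simulation-preserves-reachability :
    ∀ {p q} {Goal : A → Set p} {Goal′ : B → Set q} →
    (∀ {x y} → x ∼ y → Goal x → Goal′ y) →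
    ∀ {x y} → x ∼ y → (∃ λ x′ → Star _⟶_ x x′ × Goal x′) → ∃ λ y′ → Star _⟶′_ y y′ × Goal′ y′
  simulation-preserves-reachability goal x∼y (_ , run , g) with simulate-star x∼y run
  ... | y′ , run′ , x′∼y′ = y′ , run′ , goal x′∼y′ g

module _ {f : Level} {n : ℕ} {F : Fin n → Set f} where

  update : ((j : Fin n) → F j) → (i : Fin n) → F i → (j : Fin n) → F j
  update g i x j with j ≟ i
  ... | yes refl = x
  ... | no _     = g j

  update-≡ : ∀ g i x → update g i x i ≡ x
  update-≡ g i x with i ≟ i
  ... | yes refl = refl
  ... | no i≢i   = contradiction refl i≢i

  update-≢ : ∀ g i x j → j ≢ i → update g i x j ≡ g j
  update-≢ g i x j j≢i with j ≟ i
  ... | yes refl = contradiction refl j≢i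
  ... | no _     = refl

  update-pointwise : ∀ {q} (Q : (j : Fin n) → F j → Set q) {g i x} →
    Q i x → (∀ j → j ≢ i → Q j (g j)) → ∀ j → Q j (update g i x j)
  update-pointwise Q {i = i} qx qg j with j ≟ i
  ... | yes refl = qx
  ... | no j≢i   = qg j j≢i

module Instrumentation {Var Value : Set} (P : Program Var Value) (em : ExcludedMiddle 0ℓ) where
  open Program P
  open Semantics P

  PC′ : Set
  PC′ = (i : Fin n) → Loc' i

  data Visible : Tag → Set where
    N : Visible N
    R : Visible R
    L : Visible L

  data Ready {i : Fin n} (l : Fin (V i)) : Tag → Set where
    N  : Ready l N
    R′ : Ready l R'
    L′ : ¬ LFS l → Ready l L'

  thread-step : ∀ {pc d d′ i a x} → pc i ≡ a → Move i (π (pc , d)) a d d′ x →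
    IStep→ (pc , d) (update pc i x , d′)
  thread-step {pc} {d} {d′} {i} {x = x} pci≡a move =
    i , subst₂ (λ a y → Move i (π (pc , d)) a d d′ y) (sym pci≡a) (sym (update-≡ pc i x)) move
      , update-≢ pc i x

  Tracks : PC n V → (i : Fin n) → Loc' i → Set
  Tracks pc i x = proj₂ x ≡ pc i × Visible (proj₁ x)

  TrackedBy : S → S' → Set
  TrackedBy (pc , d) (pc′ , d′) = (∀ i → Tracks pc i (pc′ i)) × d′ ≡ d

  ReadyAt : PC′ → (i : Fin n) → Fin (V i) → Set
  ReadyAt pc i l = ∃ λ t → pc i ≡ (t , l) × Ready l t

  ready-after-move : ∀ {pc d i t t₁ l} → pc i ≡ (t , l) →
    Move i (π (pc , d)) (t , l) d d (t₁ , l) → Ready l t₁ →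
    ∃ λ pc₁ → Star IStep→ (pc , d) (pc₁ , d) × (∀ j → j ≢ i → pc₁ j ≡ pc j) × ReadyAt pc₁ i l
  ready-after-move {pc} {i = i} pci≡ move ready =
    update pc i _ , thread-step pci≡ move ◅ ε , update-≢ pc i _ , _ , update-≡ pc i _ , ready

  reach-ready : ∀ {pc d i t l} → pc i ≡ (t , l) → Visible t →
    ∃ λ pc₁ → Star IStep→ (pc , d) (pc₁ , d) × (∀ j → j ≢ i → pc₁ j ≡ pc j) × ReadyAt pc₁ i l
  reach-ready {pc} pci≡ N = pc , ε , (λ _ _ → refl) , N , pci≡ , N
  reach-ready pci≡ R = ready-after-move pci≡ (r3 _) R′
  reach-ready {pc} {d} {l = l} pci≡ L with em {LFS l} | em {cloc l (π (pc , d))}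
  ... | yes lfs | _      = ready-after-move pci≡ (r6 l lfs) N
  ... | no ¬lfs | yes c  = ready-after-move pci≡ (r4c l ¬lfs c) (L′ ¬lfs)
  ... | no ¬lfs | no ¬c  = ready-after-move pci≡ (r4n l ¬lfs ¬c) N

  fire : ∀ {pc d d′ i t l} (e : E i) → pc i ≡ (t , l) → l ≡ src e → Ready l t → act e d d′ →
    ∃ λ t′ → Visible t′ × IStep→ (pc , d) (update pc i (t′ , tgt e) , d′)
  fire {pc} {d} e pci≡ refl N α with em {cond e (π (pc , d))}
  ... | yes c = R , R , thread-step pci≡ (r1c e c α)
  ... | no ¬c = L , L , thread-step pci≡ (r1n e ¬c α)
  fire {pc} {d} e pci≡ refl R′ α with em {cond e (π (pc , d))}
  ... | yes c = R , R , thread-step pci≡ (r2c e c α)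
  ... | no ¬c = L , L , thread-step pci≡ (r2n e ¬c α)
  fire e pci≡ refl (L′ ¬lfs) α = L , L , thread-step pci≡ (r5 e ¬lfs α)

  tracked-step : ∀ {s s′ t} → TrackedBy s s′ → Step→ s t → ∃ λ t′ → Star IStep→ s′ t′ × TrackedBy t t′
  tracked-step {pc , d} {pc′ , .d} {pcₜ , dₜ} (tracks , refl) (i , e , src≡ , α , tgt≡ , frame)
    with reach-ready {pc′} {d} {i} refl (proj₂ (tracks i))
  ... | pc₁ , run , frame₁ , t₁ , pc₁i≡ , ready
    with fire e pc₁i≡ (trans (proj₁ (tracks i)) (sym src≡)) ready α
  ... | t′ , visible , step =
    (update pc₁ i (t′ , tgt e) , dₜ) , run ◅◅ step ◅ ε ,
    update-pointwise (Tracks pcₜ) (sym tgt≡ , visible) untouched , refl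
    where
    untouched : ∀ j → j ≢ i → Tracks pcₜ j (pc₁ j)
    untouched j j≢i rewrite frame₁ j j≢i | frame j j≢i = tracks j

  visible-error : ∀ {i} {x : Loc' i} → Visible (proj₁ x) → proj₂ x ≡ sink i →
    (x ≡ (N , sink i)) ⊎ (x ≡ (R , sink i)) ⊎ (x ≡ (L , sink i))
  visible-error {x = .N , _} N refl = inj₁ refl
  visible-error {x = .R , _} R refl = inj₂ (inj₁ refl)
  visible-error {x = .L , _} L refl = inj₂ (inj₂ refl)

  tracked-error : ∀ {s s′} → TrackedBy s s′ → Error s → Error' s′
  tracked-error (tracks , _) (i , at-sink) =
    i , visible-error (proj₂ (tracks i)) (trans (proj₁ (tracks i)) at-sink)

  ProjectsTo : S' → S → Set
  ProjectsTo (pc′ , d′) (pc , d) = (∀ i → proj₂ (pc′ i) ≡ pc i) × d′ ≡ d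

  move-stutters-or-follows-edge : ∀ {i σ a d d′ b} → Move i σ a d d′ b →
    (proj₂ a ≡ proj₂ b × d ≡ d′) ⊎ (∃ λ (e : E i) → proj₂ a ≡ src e × proj₂ b ≡ tgt e × act e d d′)
  move-stutters-or-follows-edge (r1c e _ α)   = inj₂ (e , refl , refl , α)
  move-stutters-or-follows-edge (r1n e _ α)   = inj₂ (e , refl , refl , α)
  move-stutters-or-follows-edge (r2c e _ α)   = inj₂ (e , refl , refl , α)
  move-stutters-or-follows-edge (r2n e _ α)   = inj₂ (e , refl , refl , α)
  move-stutters-or-follows-edge (r3 _)        = inj₁ (refl , refl)
  move-stutters-or-follows-edge (r4c _ _ _)   = inj₁ (refl , refl)
  move-stutters-or-follows-edge (r4n _ _ _)   = inj₁ (refl , refl)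
  move-stutters-or-follows-edge (r5 e _ α)    = inj₂ (e , refl , refl , α)
  move-stutters-or-follows-edge (r6 _ _)      = inj₁ (refl , refl)

  projected-step : ∀ {s′ t′ s} → ProjectsTo s′ s → IStep→ s′ t′ → ∃ λ t → Star Step→ s t × ProjectsTo t′ t
  projected-step {pc′ , d} {pcₜ′ , dₜ} {pc , .d} (locs , refl) (i , move , frame)
    with move-stutters-or-follows-edge move
  ... | inj₁ (same-loc , refl) = (pc , d) , ε , locs′ , refl
    where
    locs′ : ∀ j → proj₂ (pcₜ′ j) ≡ pc j
    locs′ j with j ≟ i
    ... | yes refl = trans (sym same-loc) (locs j)
    ... | no j≢i   = trans (cong proj₂ (frame j j≢i)) (locs j)
  ... | inj₂ (e , src≡ , tgt≡ , α) =
    π (pcₜ′ , dₜ) ,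
    (i , e , trans (sym src≡) (locs i) , α , tgt≡ , λ j j≢i → trans (cong proj₂ (frame j j≢i)) (locs j)) ◅ ε ,
    (λ _ → refl) , refl

  error-location : ∀ {i} {x : Loc' i} {l} →
    (x ≡ (N , l)) ⊎ (x ≡ (R , l)) ⊎ (x ≡ (L , l)) → proj₂ x ≡ l
  error-location (inj₁ refl)        = refl
  error-location (inj₂ (inj₁ refl)) = refl
  error-location (inj₂ (inj₂ refl)) = refl

  projected-error : ∀ {s′ s} → ProjectsTo s′ s → Error' s′ → Error s
  projected-error (locs , _) (i , at-sink) = i , trans (sym (locs i)) (error-location at-sink)

-- The instrumentation only adds stuttering moves and case splits on guards, so the
-- equivalence needs neither the absence of sink edges, nor the feedback sets, nor the
-- both-moving conditions.
lemma2 : {Var Value : Set} (P : Program Var Value) (d₀ : Var → Value) →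
    ExcludedMiddle 0ℓ →
    Semantics.SinkNoOut P →
    Semantics.FeedbackSets P →
    Semantics.BothMoving P →
    (Semantics.ErrorReachable P d₀ ⇔ Semantics.ErrorReachable' P d₀)
lemma2 P d₀ em _ _ _ =
  mk⇔ (simulation-preserves-reachability TrackedBy tracked-step tracked-error
         ((λ _ → refl , N) , refl))
      (simulation-preserves-reachability ProjectsTo projected-step projected-error
         ((λ _ → refl) , refl))
  where open Instrumentation P em
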